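{- Let $N$ be a finite set with $|N|=n\geq 2$, let $m$ be a supermodular game over $N$, and let $x^m\in\mathbb{R}^{\Upsilon\times N}$ be its payoff array. Let $\tau\in\Upsilon$ and $\Gamma\subseteq\Upsilon\setminus\{\tau\}$ be such that $x^m(\tau,\ast)=\sum_{\pi\in\Gamma}\alpha_\pi\, x^m(\pi,\ast)$ for some reals $\alpha_\pi>0$ with $\sum_{\pi\in\Gamma}\alpha_\pi=1$. Then $x^m(\pi,\ast)=x^m(\tau,\ast)$ for every $\pi\in\Gamma$.
   Context: A game over $N$ is a function $m:2^N\to\mathbb{R}$ with $m(\emptyset)=0$; it is supermodular if $m(A)+m(B)\leq m(A\cup B)+m(A\cap B)$ for all $A,B\subseteq N$. $\Upsilon$ denotes the set of all enumerations of $N$, i.e., bijections $\pi:\{1,\dots,n\}\to N$. The payoff array of $m$ is $x^m\in\mathbb{R}^{\Upsilon\times N}$ given by $x^m(\pi,i):=m(\{\pi(k):k\leq\pi^{ -1}(i)\})-m(\{\pi(k):k<\pi^{ -1}(i)\})$ for $\pi\in\Upsilon$, $i\in N$; $x^m(\pi,\ast)\in\mathbb{R}^N$ denotes its row indexed by $\pi$. -}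

module Defs where

open import Level using (Level; _⊔_) renaming (suc to lsuc)
open import Data.Nat using (ℕ)
open import Data.Fin using (Fin; _<?_; _≤?_)
open import Data.Fin.Subset using (Subset; ⊥; _∪_; _∩_)
open import Data.Fin.Permutation using (Permutation′; _⟨$⟩ʳ_; _⟨$⟩ˡ_)
open import Data.Vec using (tabulate)
open import Data.Product using (∃; _×_; _,_)
open import Data.Sum using (_⊎_)
open import Data.List using (List; []; _∷_)
open import Relation.Nullary.Decidable using (⌊_⌋)
open import Relation.Binary.Core using (Rel)
open import Relation.Binary.PropositionalEquality using (_≡_; _≢_)
open import Relation.Binary.Structures using (IsStrictTotalOrder)
open import Algebra.Structures using (IsCommutativeRing)

-- An ordered field (with propositional equality as equality on the carrier).
-- The real numbers are the intended instance.
record OrderedField (c : Level) : Set (lsuc c) where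
  infixl 6 _+_
  infixl 7 _*_
  infix 4 _<_
  field
    Carrier   : Set c
    _+_ _*_   : Carrier → Carrier → Carrier
    -_        : Carrier → Carrier
    0# 1#     : Carrier
    _<_       : Rel Carrier c
    isCommutativeRing   : IsCommutativeRing _≡_ _+_ _*_ -_ 0# 1#
    isStrictTotalOrder  : IsStrictTotalOrder _≡_ _<_
    +-mono-<  : ∀ {x y} z → x < y → x + z < y + z
    *-pos     : ∀ {x y} → 0# < x → 0# < y → 0# < x * y
    0<1       : 0# < 1#
    inverse   : ∀ x → x ≢ 0# → ∃ λ y → x * y ≡ 1#

  _-_ : Carrier → Carrier → Carrier
  x - y = x + (- y)

  infix 4 _≤_
  _≤_ : Rel Carrier c
  x ≤ y = x < y ⊎ x ≡ y

module _ {c : Level} (F : OrderedField c) where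
  open OrderedField F

  IsGame : {n : ℕ} → (Subset n → Carrier) → Set c
  IsGame m = m ⊥ ≡ 0#

  Supermodular : {n : ℕ} → (Subset n → Carrier) → Set c
  Supermodular {n} m = ∀ (A B : Subset n) → m A + m B ≤ m (A ∪ B) + m (A ∩ B)

  -- An enumeration π : Permutation′ n; π ⟨$⟩ʳ k is the player at position k,
  -- π ⟨$⟩ˡ i is the position π⁻¹(i) of player i.
  -- Players strictly before i in π.
  before : {n : ℕ} → Permutation′ n → Fin n → Subset n
  before π i = tabulate (λ j → ⌊ (π ⟨$⟩ˡ j) <? (π ⟨$⟩ˡ i) ⌋)

  upto : {n : ℕ} → Permutation′ n → Fin n → Subset n
  upto π i = tabulate (λ j → ⌊ (π ⟨$⟩ˡ j) ≤? (π ⟨$⟩ˡ i) ⌋)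

  payoff : {n : ℕ} → (Subset n → Carrier) → Permutation′ n → Fin n → Carrier
  payoff m π i = m (upto π i) - m (before π i)

  sumL : {a : Level} {A : Set a} → (A → Carrier) → List A → Carrier
  sumL f [] = 0#
  sumL f (a ∷ as) = f a + sumL f as

-- Every marginal vector x^π of a supermodular game lies in the core, m(S) ≤ Σ_{j∈S} x^π_j:
-- add the players of S one by one in the order π; by supermodularity the marginal
-- contribution of i to a coalition of players preceding it is at most x^π_i.
-- The vector x^τ is moreover efficient on every initial segment T of τ, i.e.
-- Σ_{j∈T} x^τ_j = m(T). As x^τ is a combination with positive weights summing to 1 of
-- vectors x^π with Σ_{j∈T} x^π_j ≥ m(T), equality forces Σ_{j∈T} x^π_j = m(T) for every
-- π ∈ Γ. Taking for T the players before i in τ and those up to i, and subtracting,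
-- gives x^π_i = x^τ_i.
module Submission where

open import Defs
open import Level using (Level)
open import Function using (_∘_; _⇔_; mk⇔)
open import Algebra.Bundles using (CommutativeRing)
open import Algebra.Structures using (IsCommutativeRing)
import Algebra.Properties.Ring as RingProperties
import Algebra.Properties.CommutativeSemigroup as CommutativeSemigroupProperties
open import Relation.Binary.Structures using (IsStrictTotalOrder)
import Relation.Binary.Construct.StrictToNonStrict as StrictToNonStrict
open import Relation.Binary.PropositionalEquality
open import Relation.Nullary using (¬_; contradiction; Dec; does; yes; no)
open import Relation.Nullary.Decidable using (⌊_⌋; isYes≗does; dec-true; dec-false; does-⇔)
open import Data.Product using (_×_; _,_; proj₁; proj₂)
open import Data.Sum using (inj₁; inj₂)
open import Data.Bool using (Bool; true; false; if_then_else_; _∨_)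
open import Data.Bool.Properties using (∧-zeroʳ; ∨-zeroʳ; ∨-identityʳ)
open import Data.Nat as ℕ using (ℕ; zero; suc; s≤s; s≤s⁻¹)
import Data.Nat.Properties as ℕ
open import Data.Fin as Fin using (Fin; zero; suc; toℕ; fromℕ<; _≟_)
open import Data.Fin.Properties using (toℕ-injective; toℕ<n; toℕ-fromℕ<)
open import Data.Fin.Subset using (Subset; inside; outside; ⊥; ⊤; ⁅_⁆; _∪_; _∩_; _∈_; _∉_)
open import Data.Fin.Subset.Properties
  using ( _∈?_; x∈p∩q⁻; ∩-zeroʳ; ∩-identityʳ; ∩-comm; ∩-assoc; ∩-idem; ∩-distribˡ-∪; ∩-distribʳ-∪
        ; ∪-comm; ∪-assoc; ∪-identityʳ; ∪-abs-∩)
open import Data.Fin.Permutation using (Permutation′; _⟨$⟩ʳ_; _⟨$⟩ˡ_; inverseʳ; inverseˡ)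
open import Data.Vec using (Vec; []; _∷_; here; there; lookup; tabulate)
open import Data.Vec.Properties
  using (lookup∘tabulate; tabulate∘lookup; tabulate-cong; lookup-zipWith; lookup-replicate; []=⇒lookup)
open import Data.List using (List; []; _∷_)
open import Data.List.Relation.Unary.All as All using (All; []; _∷_)

⌊⌋-true : ∀ {a} {A : Set a} (a? : Dec A) → A → ⌊ a? ⌋ ≡ true
⌊⌋-true a? a = trans (isYes≗does a?) (dec-true a? a)

⌊⌋-false : ∀ {a} {A : Set a} (a? : Dec A) → ¬ A → ⌊ a? ⌋ ≡ false
⌊⌋-false a? ¬a = trans (isYes≗does a?) (dec-false a? ¬a)

⌊⌋-⇔ : ∀ {a b} {A : Set a} {B : Set b} → A ⇔ B → (a? : Dec A) (b? : Dec B) → ⌊ a? ⌋ ≡ ⌊ b? ⌋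
⌊⌋-⇔ A⇔B a? b? = trans (isYes≗does a?) (trans (does-⇔ A⇔B a? b?) (sym (isYes≗does b?)))

lookup-ext : ∀ {a n} {A : Set a} {xs ys : Vec A n} → (∀ i → lookup xs i ≡ lookup ys i) → xs ≡ ys
lookup-ext {xs = xs} {ys} eq =
  trans (sym (tabulate∘lookup xs)) (trans (tabulate-cong eq) (tabulate∘lookup ys))

lookup-⁅⁆ : ∀ {n} (i j : Fin n) → lookup ⁅ i ⁆ j ≡ does (j ≟ i)
lookup-⁅⁆ zero    zero    = refl
lookup-⁅⁆ zero    (suc j) = lookup-replicate j outside
lookup-⁅⁆ (suc i) zero    = refl
lookup-⁅⁆ (suc i) (suc j) = lookup-⁅⁆ i j

∩-⁅⁆-∈ : ∀ {n i} {p : Subset n} → i ∈ p → p ∩ ⁅ i ⁆ ≡ ⁅ i ⁆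
∩-⁅⁆-∈ {i = zero}  {inside ∷ p} here        = cong (inside ∷_) (∩-zeroʳ p)
∩-⁅⁆-∈ {i = suc i} {b ∷ p}      (there i∈p) = cong₂ _∷_ (∧-zeroʳ b) (∩-⁅⁆-∈ i∈p)

∩-⁅⁆-∉ : ∀ {n i} {p : Subset n} → i ∉ p → p ∩ ⁅ i ⁆ ≡ ⊥
∩-⁅⁆-∉ {i = zero}  {outside ∷ p} _   = cong (outside ∷_) (∩-zeroʳ p)
∩-⁅⁆-∉ {i = zero}  {inside ∷ p}  i∉p = contradiction here i∉p
∩-⁅⁆-∉ {i = suc i} {b ∷ p}       i∉p = cong₂ _∷_ (∧-zeroʳ b) (∩-⁅⁆-∉ (i∉p ∘ there))

module _ {n : ℕ} (π : Permutation′ n) where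

  rank : Fin n → ℕ
  rank j = toℕ (π ⟨$⟩ˡ j)

  rank-injective : ∀ {i j} → rank i ≡ rank j → i ≡ j
  rank-injective {i} {j} eq = begin
    i                   ≡⟨ inverseʳ π ⟨
    π ⟨$⟩ʳ (π ⟨$⟩ˡ i)   ≡⟨ cong (π ⟨$⟩ʳ_) (toℕ-injective eq) ⟩
    π ⟨$⟩ʳ (π ⟨$⟩ˡ j)   ≡⟨ inverseʳ π ⟩
    j                   ∎
    where open ≡-Reasoning

  position-induction : ∀ {ℓ} (P : ℕ → Set ℓ) → P 0 → (∀ i → P (rank i) → P (suc (rank i))) →
                       ∀ q → q ℕ.≤ n → P q
  position-induction P base step zero    _   = base
  position-induction P base step (suc q) q<n =
    subst (P ∘ suc) rank-i≡q (step i (subst P (sym rank-i≡q) (position-induction P base step q (ℕ.<⇒≤ q<n))))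
    where
    i = π ⟨$⟩ʳ fromℕ< q<n
    rank-i≡q : rank i ≡ q
    rank-i≡q = trans (cong toℕ (inverseˡ π)) (toℕ-fromℕ< q<n)

  -- The players in the first q positions of π; before F π i is definitionally prefix (rank i).
  prefix : ℕ → Subset n
  prefix q = tabulate (λ j → ⌊ rank j ℕ.<? q ⌋)

  prefix-zero : prefix 0 ≡ ⊥
  prefix-zero = lookup-ext λ j → trans (lookup∘tabulate _ j) (sym (lookup-replicate j outside))

  prefix-all : prefix n ≡ ⊤
  prefix-all = lookup-ext λ j → begin
    lookup (prefix n) j   ≡⟨ lookup∘tabulate _ j ⟩
    ⌊ rank j ℕ.<? n ⌋     ≡⟨ ⌊⌋-true (rank j ℕ.<? n) (toℕ<n _) ⟩
    true                  ≡⟨ lookup-replicate j inside ⟨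
    lookup ⊤ j            ∎
    where open ≡-Reasoning

  prefix-suc : ∀ i → prefix (suc (rank i)) ≡ prefix (rank i) ∪ ⁅ i ⁆
  prefix-suc i = lookup-ext λ j → begin
    lookup (prefix (suc (rank i))) j              ≡⟨ lookup∘tabulate _ j ⟩
    ⌊ rank j ℕ.<? suc (rank i) ⌋                  ≡⟨ split j (j ≟ i) ⟩
    ⌊ rank j ℕ.<? rank i ⌋ ∨ does (j ≟ i)         ≡⟨ cong₂ _∨_ (lookup∘tabulate _ j) (lookup-⁅⁆ i j) ⟨
    lookup (prefix (rank i)) j ∨ lookup ⁅ i ⁆ j   ≡⟨ lookup-zipWith _∨_ j (prefix (rank i)) ⁅ i ⁆ ⟨
    lookup (prefix (rank i) ∪ ⁅ i ⁆) j            ∎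
    where
    open ≡-Reasoning
    <-suc⇔< : ∀ {j} → j ≢ i → rank j ℕ.< suc (rank i) ⇔ rank j ℕ.< rank i
    <-suc⇔< j≢i = mk⇔ (λ j<i+1 → ℕ.≤∧≢⇒< (s≤s⁻¹ j<i+1) (j≢i ∘ rank-injective)) ℕ.m<n⇒m<1+n
    split : ∀ j (j≟i : Dec (j ≡ i)) → ⌊ rank j ℕ.<? suc (rank i) ⌋ ≡ ⌊ rank j ℕ.<? rank i ⌋ ∨ does j≟i
    split j (yes refl) = trans (⌊⌋-true (rank j ℕ.<? suc (rank j)) ℕ.≤-refl) (sym (∨-zeroʳ _))
    split j (no j≢i)   =
      trans (⌊⌋-⇔ (<-suc⇔< j≢i) (rank j ℕ.<? suc (rank i)) (rank j ℕ.<? rank i)) (sym (∨-identityʳ _))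

  ∉-prefix-rank : ∀ i → i ∉ prefix (rank i)
  ∉-prefix-rank i i∈ = contradiction inside≡outside λ ()
    where
    inside≡outside : inside ≡ outside
    inside≡outside = trans (sym ([]=⇒lookup i∈))
      (trans (lookup∘tabulate (λ j → ⌊ rank j ℕ.<? rank i ⌋) i) (⌊⌋-false (rank i ℕ.<? rank i) (ℕ.<-irrefl refl)))

module _ {c : Level} (F : OrderedField c) {n : ℕ} (π : Permutation′ n) where

  upto≡prefix-suc : ∀ i → upto F π i ≡ prefix π (suc (rank π i))
  upto≡prefix-suc i = tabulate-cong λ j →
    ⌊⌋-⇔ (mk⇔ s≤s s≤s⁻¹) (π ⟨$⟩ˡ j Fin.≤? π ⟨$⟩ˡ i) (rank π j ℕ.<? suc (rank π i))

  upto≡before∪⁅⁆ : ∀ i → upto F π i ≡ before F π i ∪ ⁅ i ⁆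
  upto≡before∪⁅⁆ i = trans (upto≡prefix-suc i) (prefix-suc π i)

module OrderedFieldProperties {c : Level} (F : OrderedField c) where
  open OrderedField F
  open IsCommutativeRing isCommutativeRing
    using (+-assoc; +-comm; +-identityˡ; *-assoc; *-comm; *-identityˡ; distribˡ; distribʳ; zeroˡ; -‿inverseʳ)
  open IsStrictTotalOrder isStrictTotalOrder using () renaming (trans to <-trans; irrefl to <-irrefl)

  commutativeRing : CommutativeRing c c
  commutativeRing = record { isCommutativeRing = isCommutativeRing }

  open RingProperties (CommutativeRing.ring commutativeRing) public
    using (-‿distribʳ-*; //-rightDividesˡ; //-rightDividesʳ)
  open CommutativeSemigroupProperties (CommutativeRing.+-commutativeSemigroup commutativeRing) public
    using (interchange)

  ≤-trans : ∀ {x y z} → x ≤ y → y ≤ z → x ≤ z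
  ≤-trans = StrictToNonStrict.trans _≡_ _<_ isEquivalence (resp₂ _<_) <-trans

  <-≤-trans : ∀ {x y z} → x < y → y ≤ z → x < z
  <-≤-trans = StrictToNonStrict.<-≤-trans _≡_ _<_ <-trans (proj₁ (resp₂ _<_))

  +-monoˡ-< : ∀ {x y} z → x < y → z + x < z + y
  +-monoˡ-< {x} {y} z x<y = subst₂ _<_ (+-comm x z) (+-comm y z) (+-mono-< z x<y)

  +-monoʳ-≤ : ∀ {x y} z → x ≤ y → x + z ≤ y + z
  +-monoʳ-≤ z (inj₁ x<y)  = inj₁ (+-mono-< z x<y)
  +-monoʳ-≤ z (inj₂ refl) = inj₂ refl

  +-monoˡ-≤ : ∀ {x y} z → x ≤ y → z + x ≤ z + y
  +-monoˡ-≤ z (inj₁ x<y)  = inj₁ (+-monoˡ-< z x<y)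
  +-monoˡ-≤ z (inj₂ refl) = inj₂ refl

  +-mono-≤ : ∀ {x y u v} → x ≤ y → u ≤ v → x + u ≤ y + v
  +-mono-≤ {y = y} {u} x≤y u≤v = ≤-trans (+-monoʳ-≤ u x≤y) (+-monoˡ-≤ y u≤v)

  +-mono-≤-tight : ∀ {x y u v} → x ≤ y → u ≤ v → x + u ≡ y + v → x ≡ y × u ≡ v
  +-mono-≤-tight {u = u} (inj₁ x<y) u≤v eq = contradiction eq λ eq →
    <-irrefl eq (<-≤-trans (+-mono-< u x<y) (+-monoˡ-≤ _ u≤v))
  +-mono-≤-tight (inj₂ refl) (inj₁ u<v)  eq = contradiction eq λ eq → <-irrefl eq (+-monoˡ-< _ u<v)
  +-mono-≤-tight (inj₂ refl) (inj₂ refl) _  = refl , refl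

  x+y≤z+u⇒x≤u+[z-y] : ∀ {x y z u} → x + y ≤ z + u → x ≤ u + (z - y)
  x+y≤z+u⇒x≤u+[z-y] {x} {y} {z} {u} x+y≤z+u =
    subst₂ _≤_ (//-rightDividesʳ y x) z+u-y≡u+[z-y] (+-monoʳ-≤ (- y) x+y≤z+u)
    where
    z+u-y≡u+[z-y] : (z + u) - y ≡ u + (z - y)
    z+u-y≡u+[z-y] = trans (cong (_- y) (+-comm z u)) (+-assoc u z (- y))

  x<y⇒0<y-x : ∀ {x y} → x < y → 0# < y - x
  x<y⇒0<y-x {x} {y} x<y = subst (_< y - x) (-‿inverseʳ x) (+-mono-< (- x) x<y)

  *-monoˡ-< : ∀ {α x y} → 0# < α → x < y → α * x < α * y
  *-monoˡ-< {α} {x} {y} 0<α x<y =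
    subst₂ _<_ (+-identityˡ (α * x)) α[y-x]+αx≡αy (+-mono-< (α * x) (*-pos 0<α (x<y⇒0<y-x x<y)))
    where
    open ≡-Reasoning
    α[y-x]+αx≡αy : α * (y - x) + α * x ≡ α * y
    α[y-x]+αx≡αy = begin
      α * (y - x) + α * x           ≡⟨ cong (_+ α * x) (distribˡ α y (- x)) ⟩
      (α * y + α * (- x)) + α * x   ≡⟨ cong (λ z → (α * y + z) + α * x) (-‿distribʳ-* α x) ⟨
      ((α * y) - (α * x)) + α * x   ≡⟨ //-rightDividesˡ (α * x) (α * y) ⟩
      α * y                         ∎

  *-monoˡ-≤ : ∀ {α x y} → 0# < α → x ≤ y → α * x ≤ α * y
  *-monoˡ-≤ 0<α (inj₁ x<y)  = inj₁ (*-monoˡ-< 0<α x<y)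
  *-monoˡ-≤ 0<α (inj₂ refl) = inj₂ refl

  *-cancelˡ-≡ : ∀ {α x y} → 0# < α → α * x ≡ α * y → x ≡ y
  *-cancelˡ-≡ {α} {x} {y} 0<α αx≡αy = trans (β[αz]≡z x) (trans (cong (β *_) αx≡αy) (sym (β[αz]≡z y)))
    where
    αβ≡1 = inverse α (λ α≡0 → <-irrefl (sym α≡0) 0<α)
    β = proj₁ αβ≡1
    open ≡-Reasoning
    β[αz]≡z : ∀ z → z ≡ β * (α * z)
    β[αz]≡z z = begin
      z             ≡⟨ *-identityˡ z ⟨
      1# * z        ≡⟨ cong (_* z) (proj₂ αβ≡1) ⟨
      (α * β) * z   ≡⟨ cong (_* z) (*-comm α β) ⟩
      (β * α) * z   ≡⟨ *-assoc β α z ⟩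
      β * (α * z)   ∎

  module _ {a} {A : Set a} (w : A → Carrier) where

    weightedSum-mono-≤ : ∀ {g h : A → Carrier} {Γ} → All (λ p → 0# < w p) Γ → All (λ p → g p ≤ h p) Γ →
                         sumL F (λ p → w p * g p) Γ ≤ sumL F (λ p → w p * h p) Γ
    weightedSum-mono-≤ []           []            = inj₂ refl
    weightedSum-mono-≤ (0<w ∷ 0<ws) (g≤h ∷ gs≤hs) =
      +-mono-≤ (*-monoˡ-≤ 0<w g≤h) (weightedSum-mono-≤ 0<ws gs≤hs)

    weightedSum-mono-≤-tight : ∀ {g h : A → Carrier} {Γ} → All (λ p → 0# < w p) Γ → All (λ p → g p ≤ h p) Γ →
                               sumL F (λ p → w p * g p) Γ ≡ sumL F (λ p → w p * h p) Γ → All (λ p → g p ≡ h p) Γ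
    weightedSum-mono-≤-tight []           []            _ = []
    weightedSum-mono-≤-tight (0<w ∷ 0<ws) (g≤h ∷ gs≤hs) eq
      with +-mono-≤-tight (*-monoˡ-≤ 0<w g≤h) (weightedSum-mono-≤ 0<ws gs≤hs) eq
    ... | head-eq , tail-eq = *-cancelˡ-≡ 0<w head-eq ∷ weightedSum-mono-≤-tight 0<ws gs≤hs tail-eq

    weightedSum-const : ∀ x Γ → sumL F (λ p → w p * x) Γ ≡ sumL F w Γ * x
    weightedSum-const x []      = sym (zeroˡ x)
    weightedSum-const x (p ∷ Γ) =
      trans (cong (w p * x +_) (weightedSum-const x Γ)) (sym (distribʳ x (w p) (sumL F w Γ)))

module SubsetSum {c : Level} (F : OrderedField c) where
  open OrderedField F
  open IsCommutativeRing isCommutativeRing using (+-assoc; +-comm; +-identityˡ; zeroʳ; distribˡ)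
  open OrderedFieldProperties F using (interchange)

  when : Bool → Carrier → Carrier
  when b x = if b then x else 0#

  when-0 : ∀ b → when b 0# ≡ 0#
  when-0 true  = refl
  when-0 false = refl

  when-+ : ∀ b x y → when b (x + y) ≡ when b x + when b y
  when-+ true  x y = refl
  when-+ false x y = sym (+-identityˡ 0#)

  when-*ˡ : ∀ b α x → when b (α * x) ≡ α * when b x
  when-*ˡ true  α x = refl
  when-*ˡ false α x = sym (zeroʳ α)

  sumOver : ∀ {n} → Subset n → (Fin n → Carrier) → Carrier
  sumOver []      f = 0#
  sumOver (b ∷ p) f = when b (f zero) + sumOver p (f ∘ suc)

  sumOver-cong : ∀ {n} (p : Subset n) {f g} → (∀ j → f j ≡ g j) → sumOver p f ≡ sumOver p g
  sumOver-cong []      f≗g = refl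
  sumOver-cong (b ∷ p) f≗g = cong₂ _+_ (cong (when b) (f≗g zero)) (sumOver-cong p (f≗g ∘ suc))

  sumOver-⊥ : ∀ {n} (f : Fin n → Carrier) → sumOver ⊥ f ≡ 0#
  sumOver-⊥ {zero}  f = refl
  sumOver-⊥ {suc n} f = trans (+-identityˡ _) (sumOver-⊥ (f ∘ suc))

  sumOver-∪-⁅⁆ : ∀ {n i} {p : Subset n} (f : Fin n → Carrier) → i ∉ p → sumOver (p ∪ ⁅ i ⁆) f ≡ sumOver p f + f i
  sumOver-∪-⁅⁆ {i = zero} {inside ∷ p} f i∉p = contradiction here i∉p
  sumOver-∪-⁅⁆ {i = zero} {outside ∷ p} f _ = begin
    f zero + sumOver (p ∪ ⊥) (f ∘ suc)    ≡⟨ cong (λ q → f zero + sumOver q (f ∘ suc)) (∪-identityʳ p) ⟩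
    f zero + sumOver p (f ∘ suc)          ≡⟨ +-comm _ _ ⟩
    sumOver p (f ∘ suc) + f zero          ≡⟨ cong (_+ f zero) (+-identityˡ _) ⟨
    (0# + sumOver p (f ∘ suc)) + f zero   ∎
    where open ≡-Reasoning
  sumOver-∪-⁅⁆ {i = suc i} {b ∷ p} f i∉p = begin
    when (b ∨ false) (f zero) + sumOver (p ∪ ⁅ i ⁆) (f ∘ suc)
      ≡⟨ cong₂ _+_ (cong (λ b → when b (f zero)) (∨-identityʳ b)) (sumOver-∪-⁅⁆ (f ∘ suc) (i∉p ∘ there)) ⟩
    when b (f zero) + (sumOver p (f ∘ suc) + f (suc i))
      ≡⟨ +-assoc _ _ _ ⟨
    (when b (f zero) + sumOver p (f ∘ suc)) + f (suc i)
      ∎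
    where open ≡-Reasoning

  sumOver-0 : ∀ {n} (p : Subset n) → sumOver p (λ _ → 0#) ≡ 0#
  sumOver-0 []      = refl
  sumOver-0 (b ∷ p) = trans (cong₂ _+_ (when-0 b) (sumOver-0 p)) (+-identityˡ 0#)

  sumOver-+ : ∀ {n} (p : Subset n) f g → sumOver p (λ j → f j + g j) ≡ sumOver p f + sumOver p g
  sumOver-+ []      f g = sym (+-identityˡ 0#)
  sumOver-+ (b ∷ p) f g =
    trans (cong₂ _+_ (when-+ b _ _) (sumOver-+ p (f ∘ suc) (g ∘ suc))) (interchange _ _ _ _)

  sumOver-*ˡ : ∀ {n} (p : Subset n) α f → sumOver p (λ j → α * f j) ≡ α * sumOver p f
  sumOver-*ˡ []      α f = sym (zeroʳ α)
  sumOver-*ˡ (b ∷ p) α f =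
    trans (cong₂ _+_ (when-*ˡ b α _) (sumOver-*ˡ p α (f ∘ suc))) (sym (distribˡ α _ _))

  sumOver-weightedSum : ∀ {a n} {A : Set a} (p : Subset n) (w : A → Carrier) (g : A → Fin n → Carrier) Γ →
                        sumOver p (λ j → sumL F (λ x → w x * g x j) Γ) ≡ sumL F (λ x → w x * sumOver p (g x)) Γ
  sumOver-weightedSum p w g []      = sumOver-0 p
  sumOver-weightedSum p w g (x ∷ Γ) =
    trans (sumOver-+ p _ _) (cong₂ _+_ (sumOver-*ˡ p (w x) (g x)) (sumOver-weightedSum p w g Γ))

module Game {c : Level} (F : OrderedField c) {n : ℕ} (m : Subset n → OrderedField.Carrier F)
            (m∅≡0 : IsGame F m) (supermodular : Supermodular F m) where
  open OrderedField F
  open IsCommutativeRing isCommutativeRing using (+-comm; *-identityˡ)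
  open OrderedFieldProperties F
  open SubsetSum F

  CoreConstraint : Permutation′ n → Subset n → Set c
  CoreConstraint π T = m T ≤ sumOver T (payoff F m π)

  marginal≤payoff : ∀ (π : Permutation′ n) i (S : Subset n) →
                    m (S ∩ before F π i ∪ ⁅ i ⁆) ≤ m (S ∩ before F π i) + payoff F m π i
  marginal≤payoff π i S = x+y≤z+u⇒x≤u+[z-y]
    (subst₂ (λ U V → m A + m B ≤ m U + m V) A∪B≡upto A∩B≡S∩B (supermodular A B))
    where
    B = before F π i
    A = S ∩ B ∪ ⁅ i ⁆
    open ≡-Reasoning
    A∪B≡upto : A ∪ B ≡ upto F π i
    A∪B≡upto = begin
      (S ∩ B ∪ ⁅ i ⁆) ∪ B   ≡⟨ ∪-comm A B ⟩
      B ∪ (S ∩ B ∪ ⁅ i ⁆)   ≡⟨ ∪-assoc B (S ∩ B) ⁅ i ⁆ ⟨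
      (B ∪ S ∩ B) ∪ ⁅ i ⁆   ≡⟨ cong (λ T → (B ∪ T) ∪ ⁅ i ⁆) (∩-comm S B) ⟩
      (B ∪ B ∩ S) ∪ ⁅ i ⁆   ≡⟨ cong (_∪ ⁅ i ⁆) (∪-abs-∩ B S) ⟩
      B ∪ ⁅ i ⁆             ≡⟨ upto≡before∪⁅⁆ F π i ⟨
      upto F π i            ∎
    A∩B≡S∩B : A ∩ B ≡ S ∩ B
    A∩B≡S∩B = begin
      (S ∩ B ∪ ⁅ i ⁆) ∩ B       ≡⟨ ∩-distribʳ-∪ B (S ∩ B) ⁅ i ⁆ ⟩
      (S ∩ B) ∩ B ∪ ⁅ i ⁆ ∩ B   ≡⟨ cong₂ _∪_ (trans (∩-assoc S B B) (cong (S ∩_) (∩-idem B)))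
                                             (trans (∩-comm ⁅ i ⁆ B) (∩-⁅⁆-∉ (∉-prefix-rank π i))) ⟩
      S ∩ B ∪ ⊥                 ≡⟨ ∪-identityʳ (S ∩ B) ⟩
      S ∩ B                     ∎

  core-step : ∀ (π : Permutation′ n) i (S : Subset n) →
              CoreConstraint π (S ∩ before F π i) → CoreConstraint π (S ∩ prefix π (suc (rank π i)))
  core-step π i S ih with i ∈? S
  ... | yes i∈S = subst (CoreConstraint π) (sym S∩prefix-suc≡) (≤-trans (marginal≤payoff π i S) sum-bound)
    where
    B = before F π i
    S∩prefix-suc≡ : S ∩ prefix π (suc (rank π i)) ≡ S ∩ B ∪ ⁅ i ⁆
    S∩prefix-suc≡ = trans (cong (S ∩_) (prefix-suc π i))
                          (trans (∩-distribˡ-∪ S B ⁅ i ⁆) (cong (S ∩ B ∪_) (∩-⁅⁆-∈ i∈S)))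
    i∉S∩B : i ∉ S ∩ B
    i∉S∩B i∈S∩B = ∉-prefix-rank π i (proj₂ (x∈p∩q⁻ S B i∈S∩B))
    sum-bound : m (S ∩ B) + payoff F m π i ≤ sumOver (S ∩ B ∪ ⁅ i ⁆) (payoff F m π)
    sum-bound = subst (m (S ∩ B) + payoff F m π i ≤_) (sym (sumOver-∪-⁅⁆ (payoff F m π) i∉S∩B))
                      (+-monoʳ-≤ _ ih)
  ... | no i∉S = subst (CoreConstraint π) (sym S∩prefix-suc≡) ih
    where
    B = before F π i
    S∩prefix-suc≡ : S ∩ prefix π (suc (rank π i)) ≡ S ∩ B
    S∩prefix-suc≡ = trans (cong (S ∩_) (prefix-suc π i))
                          (trans (∩-distribˡ-∪ S B ⁅ i ⁆) (trans (cong (S ∩ B ∪_) (∩-⁅⁆-∉ i∉S)) (∪-identityʳ _)))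

  payoff-in-core : ∀ (π : Permutation′ n) (S : Subset n) → CoreConstraint π S
  payoff-in-core π S = subst (CoreConstraint π) (trans (cong (S ∩_) (prefix-all π)) (∩-identityʳ S))
    (position-induction π (λ q → CoreConstraint π (S ∩ prefix π q)) base (λ i → core-step π i S) n ℕ.≤-refl)
    where
    base : CoreConstraint π (S ∩ prefix π 0)
    base = subst (CoreConstraint π) (sym (trans (cong (S ∩_) (prefix-zero π)) (∩-zeroʳ S)))
                 (inj₂ (trans m∅≡0 (sym (sumOver-⊥ (payoff F m π)))))

  sumOver-upto : ∀ (π : Permutation′ n) i f → sumOver (upto F π i) f ≡ sumOver (before F π i) f + f i
  sumOver-upto π i f =
    trans (cong (λ T → sumOver T f) (upto≡before∪⁅⁆ F π i)) (sumOver-∪-⁅⁆ f (∉-prefix-rank π i))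

  sumOver-upto-minus-before : ∀ (π : Permutation′ n) i f → sumOver (upto F π i) f - sumOver (before F π i) f ≡ f i
  sumOver-upto-minus-before π i f =
    trans (cong (_- sumOver (before F π i) f) (trans (sumOver-upto π i f) (+-comm _ _)))
          (//-rightDividesʳ (sumOver (before F π i) f) (f i))

  payoff-efficient : ∀ (π : Permutation′ n) q → q ℕ.≤ n → m (prefix π q) ≡ sumOver (prefix π q) (payoff F m π)
  payoff-efficient π = position-induction π (λ q → m (prefix π q) ≡ sumOver (prefix π q) x) base step
    where
    x = payoff F m π
    base : m (prefix π 0) ≡ sumOver (prefix π 0) x
    base = subst (λ T → m T ≡ sumOver T x) (sym (prefix-zero π)) (trans m∅≡0 (sym (sumOver-⊥ x)))
    step : ∀ i → m (before F π i) ≡ sumOver (before F π i) x →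
           m (prefix π (suc (rank π i))) ≡ sumOver (prefix π (suc (rank π i))) x
    step i ih = subst (λ T → m T ≡ sumOver T x) (upto≡prefix-suc F π i) (begin
      m (upto F π i)                   ≡⟨ //-rightDividesˡ (m (before F π i)) (m (upto F π i)) ⟨
      x i + m (before F π i)           ≡⟨ +-comm _ _ ⟩
      m (before F π i) + x i           ≡⟨ cong (_+ x i) ih ⟩
      sumOver (before F π i) x + x i   ≡⟨ sumOver-upto π i x ⟨
      sumOver (upto F π i) x           ∎)
      where open ≡-Reasoning

  module _ (τ : Permutation′ n) (Γ : List (Permutation′ n × Carrier))
           (0<α : All (λ p → 0# < proj₂ p) Γ) (Σα≡1 : sumL F proj₂ Γ ≡ 1#)
           (x^τ≡Σαx^π : ∀ i → payoff F m τ i ≡ sumL F (λ p → proj₂ p * payoff F m (proj₁ p) i) Γ) where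

    tight⇒components-tight : ∀ T → m T ≡ sumOver T (payoff F m τ) →
                             All (λ p → m T ≡ sumOver T (payoff F m (proj₁ p))) Γ
    tight⇒components-tight T tight = weightedSum-mono-≤-tight proj₂ 0<α
      (All.universal (λ p → payoff-in-core (proj₁ p) T) Γ) (begin
        sumL F (λ p → proj₂ p * m T) Γ                                       ≡⟨ weightedSum-const proj₂ (m T) Γ ⟩
        sumL F proj₂ Γ * m T                                                 ≡⟨ cong (_* m T) Σα≡1 ⟩
        1# * m T                                                             ≡⟨ *-identityˡ (m T) ⟩
        m T                                                                  ≡⟨ tight ⟩
        sumOver T (payoff F m τ)                                             ≡⟨ sumOver-cong T x^τ≡Σαx^π ⟩
        sumOver T (λ i → sumL F (λ p → proj₂ p * payoff F m (proj₁ p) i) Γ)  ≡⟨ sumOver-weightedSum T proj₂ _ Γ ⟩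
        sumL F (λ p → proj₂ p * sumOver T (payoff F m (proj₁ p))) Γ          ∎)
      where open ≡-Reasoning

    marginal-vectors-equal : All (λ p → ∀ i → payoff F m (proj₁ p) i ≡ payoff F m τ i) Γ
    marginal-vectors-equal = All.tabulate λ {p} p∈Γ i → let x^π = payoff F m (proj₁ p) in begin
      x^π i                                                 ≡⟨ sumOver-upto-minus-before τ i x^π ⟨
      sumOver (upto F τ i) x^π - sumOver (before F τ i) x^π ≡⟨ cong₂ _-_ (All.lookup (upto-tight i) p∈Γ)
                                                                         (All.lookup (before-tight i) p∈Γ) ⟨
      m (upto F τ i) - m (before F τ i)                     ∎
      where
      open ≡-Reasoning
      before-tight : ∀ i → All (λ p → m (before F τ i) ≡ sumOver (before F τ i) (payoff F m (proj₁ p))) Γ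
      before-tight i = tight⇒components-tight (before F τ i) (payoff-efficient τ (rank τ i) (ℕ.<⇒≤ (toℕ<n _)))
      upto-tight : ∀ i → All (λ p → m (upto F τ i) ≡ sumOver (upto F τ i) (payoff F m (proj₁ p))) Γ
      upto-tight i = tight⇒components-tight (upto F τ i)
        (subst (λ T → m T ≡ sumOver T (payoff F m τ)) (sym (upto≡prefix-suc F τ i))
               (payoff-efficient τ (suc (rank τ i)) (toℕ<n _)))

lemma2 : ∀ {c : Level} (F : OrderedField c) (n : ℕ) → 2 ℕ.≤ n →
    (m : Subset n → OrderedField.Carrier F) →
    IsGame F m → Supermodular F m →
    (τ : Permutation′ n) →
    (Γ : List (Permutation′ n × OrderedField.Carrier F)) →
    All (λ p → ¬ (∀ k → proj₁ p ⟨$⟩ʳ k ≡ τ ⟨$⟩ʳ k)) Γ →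
    All (λ p → OrderedField._<_ F (OrderedField.0# F) (proj₂ p)) Γ →
    sumL F proj₂ Γ ≡ OrderedField.1# F →
    (∀ i → payoff F m τ i ≡ sumL F (λ p → OrderedField._*_ F (proj₂ p) (payoff F m (proj₁ p) i)) Γ) →
    All (λ p → ∀ i → payoff F m (proj₁ p) i ≡ payoff F m τ i) Γ
lemma2 F n _ m m∅≡0 supermodular τ Γ _ = Game.marginal-vectors-equal F m m∅≡0 supermodular τ Γ
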